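{- Let $m\geq 1$ and $n\geq 1$ be integers. The graph $m\Gamma(\mathbb{Z}_9)+n\Gamma(\mathbb{Z}_4)$ (the join of $m\Gamma(\mathbb{Z}_9)$ and $n\Gamma(\mathbb{Z}_4)$) admits a distance antimagic labeling if and only if $n=1$.
   Context: For an integer $n \geq 2$, the zero-divisor graph $\Gamma(\mathbb{Z}_n)$ is the simple graph whose vertex set is the set of nonzero zero-divisors of the ring $\mathbb{Z}_n$, two distinct vertices $u,v$ being adjacent iff $uv \equiv 0 \pmod n$. For a graph $H$ and positive integer $k$, $kH$ denotes the disjoint union of $k$ copies of $H$. For graphs $G,H$, the join $G+H$ is the graph obtained from the disjoint union of $G$ and $H$ by adding every edge between a vertex of $G$ and a vertex of $H$. A distance antimagic labeling (DAML) of a graph $G$ with $N$ vertices is a bijection $f:V(G)\to\{1,\dots,N\}$ such that the weights $w(v)=\sum_{u\in N(v)} f(u)$, where $N(v)$ is the open neighbourhood of $v$, are pairwise distinct over all vertices $v$. A graph admits DAML if such a labeling exists. -}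

module Defs where

open import Data.Nat using (ℕ; zero; suc; _+_; _*_; _≡ᵇ_; NonZero)
open import Data.Nat.DivMod using (_%_)
open import Data.Bool using (Bool; true; false; _∧_; not; if_then_else_)
open import Data.Fin using (Fin; toℕ; splitAt; remQuot)
open import Data.List using (List; length; lookup; upTo; allFin; map; filterᵇ)
open import Data.Bool.ListAction using (any)
open import Data.Nat.ListAction using (sum)
open import Data.Product using (_×_; _,_; Σ)
open import Data.Sum using (inj₁; inj₂)
open import Function.Definitions using (Bijective; Injective)
open import Relation.Binary.PropositionalEquality using (_≡_)

record Graph : Set where
  field
    V   : ℕ
    adj : Fin V → Fin V → Bool
open Graph public

isZeroDivisor : (n : ℕ) → .{{NonZero n}} → ℕ → Bool
isZeroDivisor n x =
  not (x ≡ᵇ 0) ∧ any (λ y → not (y ≡ᵇ 0) ∧ ((x * y) % n ≡ᵇ 0)) (upTo n)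

zeroDivisors : (n : ℕ) → .{{NonZero n}} → List ℕ
zeroDivisors n = filterᵇ (isZeroDivisor n) (upTo n)

ZDGraph : (n : ℕ) → .{{NonZero n}} → Graph
ZDGraph n = record
  { V   = length (zeroDivisors n)
  ; adj = λ i j → not (toℕ i ≡ᵇ toℕ j)
                  ∧ ((lookup (zeroDivisors n) i * lookup (zeroDivisors n) j) % n ≡ᵇ 0)
  }

-- k H : disjoint union of k copies of H (vertex (c , x) ↦ copy c, vertex x).
copies : ℕ → Graph → Graph
copies k H = record
  { V   = k * V H
  ; adj = λ a b → go (remQuot {k} (V H) a) (remQuot {k} (V H) b)
  }
  where
  go : Fin k × Fin (V H) → Fin k × Fin (V H) → Bool
  go (c , x) (d , y) = (toℕ c ≡ᵇ toℕ d) ∧ adj H x y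

join : Graph → Graph → Graph
join G H = record
  { V   = V G + V H
  ; adj = λ a b → go (splitAt (V G) a) (splitAt (V G) b)
  }
  where
  go : _ → _ → Bool
  go (inj₁ x) (inj₁ y) = adj G x y
  go (inj₂ x) (inj₂ y) = adj H x y
  go (inj₁ _) (inj₂ _) = true
  go (inj₂ _) (inj₁ _) = true

-- Weight of v under labeling f (label of u is toℕ (f u) + 1 ∈ {1..N}).
weight : (G : Graph) → (Fin (V G) → Fin (V G)) → Fin (V G) → ℕ
weight G f v =
  sum (map (λ u → if adj G v u then suc (toℕ (f u)) else 0) (allFin (V G)))

IsDAML : (G : Graph) → (Fin (V G) → Fin (V G)) → Set
IsDAML G f = Bijective _≡_ _≡_ f × Injective _≡_ _≡_ (weight G f)

HasDAML : Graph → Set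
HasDAML G = Σ (Fin (V G) → Fin (V G)) (IsDAML G)

-- Γ(ℤ₉) is K₂ (on 3, 6) and Γ(ℤ₄) is K₁ (on 2), so the graph is m K₂ + n K₁. For n ≥ 2 two
-- of the K₁ vertices have the same neighbourhood (all of m K₂), hence equal weights under every
-- labelling.
-- For n = 1 label the 2m vertices of m K₂ by 1, …, 2m and the apex by 2m + 1. The apex has weight
-- 1 + ⋯ + 2m = m (2m + 1), a multiple of 2m + 1, while a vertex of m K₂ sees its partner and the
-- apex, so its weight lies strictly between 2m + 1 and 2 (2m + 1); distinct partners give distinct
-- weights.
module Submission where

open import Defs
open import Data.Nat using (ℕ; _≤_)
open import Function.Bundles using (_⇔_)
open import Relation.Binary.PropositionalEquality using (_≡_)

open import Data.Bool using (Bool; true; false; _∧_; if_then_else_)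
open import Data.Bool.Properties using (∧-zeroʳ; T-≡)
open import Data.Fin as F using (Fin; toℕ; splitAt; combine; opposite; _↑ˡ_; _↑ʳ_)
open import Data.Fin.Properties as FP
  using (toℕ-injective; splitAt-↑ˡ; splitAt-↑ʳ; toℕ-↑ˡ; toℕ-↑ʳ; remQuot-combine; combine-remQuot;
         join-splitAt; combine-injective; opposite-involutive; toℕ<n)
open import Data.List using (tabulate)
open import Data.List.Properties using (map-tabulate)
import Data.Nat.ListAction as List
open import Data.Nat.Base using (zero; suc; _+_; _*_; _≡ᵇ_; _<_; s≤s)
open import Data.Nat.Divisibility using (_∣_; ∣m+n∣m⇒∣n; ∣⇒≤; ∣-refl; divides)
open import Data.Nat.Properties as NP
  using (+-identityʳ; +-assoc; +-comm; +-cancelʳ-≡; suc-injective; ≡ᵇ⇒≡; ≡⇒≡ᵇ; <⇒≱)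
open import Data.Nat.Tactic.RingSolver using (solve-∀)
open import Data.Product using (_×_; _,_)
open import Data.Sum using (inj₁; inj₂)
open import Function using (_∘_; id; Equivalence; mk⇔)
open import Function.Construct.Identity using (bijective)
open import Relation.Nullary using (¬_; contradiction)
open import Relation.Binary.PropositionalEquality
  using (_≢_; refl; sym; trans; cong; cong₂; subst; module ≡-Reasoning)

open import Algebra.Properties.CommutativeMonoid.Sum NP.+-0-commutativeMonoid
  using (sum-syntax; sum-cong-≗; sum-replicate-zero)
open import Algebra.Properties.CommutativeSemigroup NP.+-commutativeSemigroup using (x∙yz≈y∙xz)

∑-split : ∀ a b (h : Fin (a + b) → ℕ) →
  ∑[ i < a + b ] h i ≡ ∑[ i < a ] h (i ↑ˡ b) + ∑[ j < b ] h (a ↑ʳ j)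
∑-split zero    b h = refl
∑-split (suc a) b h = trans (cong (h F.zero +_) (∑-split a b (h ∘ F.suc))) (sym (+-assoc (h F.zero) _ _))

∑-combine : ∀ m n (h : Fin (m * n) → ℕ) →
  ∑[ i < m * n ] h i ≡ ∑[ c < m ] ∑[ j < n ] h (combine c j)
∑-combine zero    n h = refl
∑-combine (suc m) n h =
  trans (∑-split n (m * n) h) (cong (∑[ j < n ] h (combine {suc m} F.zero j) +_) (∑-combine m n (h ∘ (n ↑ʳ_))))

∑-zero : ∀ n (h : Fin n → ℕ) → (∀ i → h i ≡ 0) → ∑[ i < n ] h i ≡ 0
∑-zero n h h≡0 = trans (sum-cong-≗ h≡0) (sum-replicate-zero n)

∑-concentrated : ∀ n (h : Fin n → ℕ) a → (∀ i → i ≢ a → h i ≡ 0) → ∑[ i < n ] h i ≡ h a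
∑-concentrated (suc n) h F.zero h≡0 =
  trans (cong (h F.zero +_) (∑-zero n (h ∘ F.suc) (λ i → h≡0 (F.suc i) λ ()))) (+-identityʳ _)
∑-concentrated (suc n) h (F.suc a) h≡0 =
  cong₂ _+_ (h≡0 F.zero λ ()) (∑-concentrated n (h ∘ F.suc) a (λ i i≢a → h≡0 (F.suc i) (i≢a ∘ FP.suc-injective)))

∑-suc : ∀ n (h : Fin n → ℕ) → ∑[ i < n ] suc (h i) ≡ n + ∑[ i < n ] h i
∑-suc zero    h = refl
∑-suc (suc n) h =
  cong suc (trans (cong (h F.zero +_) (∑-suc n (h ∘ F.suc))) (x∙yz≈y∙xz (h F.zero) n _))

∑-suc-toℕ-even : ∀ m → ∑[ i < m * 2 ] suc (toℕ i) ≡ m * suc (m * 2)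
∑-suc-toℕ-even zero    = refl
∑-suc-toℕ-even (suc m) = begin
  1 + (2 + ∑[ i < m * 2 ] suc (suc (suc (toℕ i))))       ≡⟨ cong (λ s → 3 + s) (∑-suc (m * 2) _) ⟩
  3 + (m * 2 + ∑[ i < m * 2 ] suc (suc (toℕ i)))         ≡⟨ cong (λ s → 3 + (m * 2 + s)) (∑-suc (m * 2) _) ⟩
  3 + (m * 2 + (m * 2 + ∑[ i < m * 2 ] suc (toℕ i)))     ≡⟨ cong (λ s → 3 + (m * 2 + (m * 2 + s))) (∑-suc-toℕ-even m) ⟩
  3 + (m * 2 + (m * 2 + m * suc (m * 2)))                ≡⟨ step m ⟩
  suc m * suc (suc m * 2)                                ∎
  where
  open ≡-Reasoning
  step : ∀ m → 3 + (m * 2 + (m * 2 + m * suc (m * 2))) ≡ suc m * suc (suc m * 2)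
  step = solve-∀

≡ᵇ-refl : ∀ n → (n ≡ᵇ n) ≡ true
≡ᵇ-refl n = Equivalence.to T-≡ (≡⇒≡ᵇ n n refl)

≢⇒≡ᵇ-false : ∀ {m n} → m ≢ n → (m ≡ᵇ n) ≡ false
≢⇒≡ᵇ-false {m} {n} m≢n with m ≡ᵇ n in eq
... | false = refl
... | true  = contradiction (≡ᵇ⇒≡ m n (Equivalence.from T-≡ eq)) m≢n

weightBy : (G : Graph) → (Fin (V G) → ℕ) → Fin (V G) → ℕ
weightBy G ℓ v = ∑[ u < V G ] (if adj G v u then ℓ u else 0)

sum-tabulate : ∀ n (h : Fin n → ℕ) → List.sum (tabulate h) ≡ ∑[ i < n ] h i
sum-tabulate zero    h = refl
sum-tabulate (suc n) h = cong (h F.zero +_) (sum-tabulate n (h ∘ F.suc))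

weight≡weightBy : ∀ G f v → weight G f v ≡ weightBy G (suc ∘ toℕ ∘ f) v
weight≡weightBy G f v = trans (cong List.sum (map-tabulate {n = V G} id _)) (sum-tabulate (V G) _)

weightBy-cong-adj : ∀ G ℓ p q → (∀ u → adj G p u ≡ adj G q u) → weightBy G ℓ p ≡ weightBy G ℓ q
weightBy-cong-adj G ℓ p q row = sum-cong-≗ (λ u → cong (λ b → if b then ℓ u else 0) (row u))

twins⇒¬HasDAML : ∀ G p q → p ≢ q → (∀ u → adj G p u ≡ adj G q u) → ¬ HasDAML G
twins⇒¬HasDAML G p q p≢q row (f , _ , weight-injective) = p≢q (weight-injective (begin
  weight G f p                 ≡⟨ weight≡weightBy G f p ⟩
  weightBy G (suc ∘ toℕ ∘ f) p ≡⟨ weightBy-cong-adj G _ p q row ⟩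
  weightBy G (suc ∘ toℕ ∘ f) q ≡⟨ weight≡weightBy G f q ⟨
  weight G f q                 ∎))
  where open ≡-Reasoning

Edgeless : Graph → Set
Edgeless G = ∀ x y → adj G x y ≡ false

weightBy-edgeless : ∀ G → Edgeless G → ∀ ℓ v → weightBy G ℓ v ≡ 0
weightBy-edgeless G edgeless ℓ v = ∑-zero (V G) _ (λ u → cong (λ b → if b then ℓ u else 0) (edgeless v u))

module _ (G H : Graph) where

  join-adj-ˡˡ : ∀ x x′ → adj (join G H) (x ↑ˡ V H) (x′ ↑ˡ V H) ≡ adj G x x′
  join-adj-ˡˡ x x′ rewrite splitAt-↑ˡ (V G) x (V H) | splitAt-↑ˡ (V G) x′ (V H) = refl

  join-adj-ˡʳ : ∀ x y → adj (join G H) (x ↑ˡ V H) (V G ↑ʳ y) ≡ true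
  join-adj-ˡʳ x y rewrite splitAt-↑ˡ (V G) x (V H) | splitAt-↑ʳ (V G) (V H) y = refl

  join-adj-ʳˡ : ∀ y x → adj (join G H) (V G ↑ʳ y) (x ↑ˡ V H) ≡ true
  join-adj-ʳˡ y x rewrite splitAt-↑ʳ (V G) (V H) y | splitAt-↑ˡ (V G) x (V H) = refl

  join-adj-ʳʳ : ∀ y y′ → adj (join G H) (V G ↑ʳ y) (V G ↑ʳ y′) ≡ adj H y y′
  join-adj-ʳʳ y y′ rewrite splitAt-↑ʳ (V G) (V H) y | splitAt-↑ʳ (V G) (V H) y′ = refl

  weightBy-join-ˡ : ∀ ℓ x →
    weightBy (join G H) ℓ (x ↑ˡ V H) ≡ weightBy G (ℓ ∘ (_↑ˡ V H)) x + ∑[ y < V H ] ℓ (V G ↑ʳ y)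
  weightBy-join-ˡ ℓ x = trans (∑-split (V G) (V H) _) (cong₂ _+_
    (sum-cong-≗ λ x′ → cong (λ b → if b then ℓ (x′ ↑ˡ V H) else 0) (join-adj-ˡˡ x x′))
    (sum-cong-≗ λ y → cong (λ b → if b then ℓ (V G ↑ʳ y) else 0) (join-adj-ˡʳ x y)))

  weightBy-join-ʳ : ∀ ℓ y →
    weightBy (join G H) ℓ (V G ↑ʳ y) ≡ ∑[ x < V G ] ℓ (x ↑ˡ V H) + weightBy H (ℓ ∘ (V G ↑ʳ_)) y
  weightBy-join-ʳ ℓ y = trans (∑-split (V G) (V H) _) (cong₂ _+_
    (sum-cong-≗ λ x → cong (λ b → if b then ℓ (x ↑ˡ V H) else 0) (join-adj-ʳˡ y x))
    (sum-cong-≗ λ y′ → cong (λ b → if b then ℓ (V G ↑ʳ y′) else 0) (join-adj-ʳʳ y y′)))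

  join-twins-ʳ : ∀ p q → (∀ y → adj H p y ≡ adj H q y) →
    ∀ u → adj (join G H) (V G ↑ʳ p) u ≡ adj (join G H) (V G ↑ʳ q) u
  join-twins-ʳ p q row u rewrite splitAt-↑ʳ (V G) (V H) p | splitAt-↑ʳ (V G) (V H) q
    with splitAt (V G) u
  ... | inj₁ _ = refl
  ... | inj₂ y = row y

  join-edgeless-¬HasDAML : Edgeless H → (p q : Fin (V H)) → p ≢ q → ¬ HasDAML (join G H)
  join-edgeless-¬HasDAML edgeless p q p≢q = twins⇒¬HasDAML (join G H) (V G ↑ʳ p) (V G ↑ʳ q)
    (p≢q ∘ FP.↑ʳ-injective (V G) p q)
    (join-twins-ʳ p q λ y → trans (edgeless p y) (sym (edgeless q y)))

module _ (k : ℕ) (H : Graph) where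

  copies-adj : ∀ (c : Fin k) x (d : Fin k) y →
    adj (copies k H) (combine c x) (combine d y) ≡ (toℕ c ≡ᵇ toℕ d) ∧ adj H x y
  copies-adj c x d y = cong₂ adjacentCopies (remQuot-combine c x) (remQuot-combine d y)
    where
    adjacentCopies : Fin k × Fin (V H) → Fin k × Fin (V H) → Bool
    adjacentCopies (c , x) (d , y) = (toℕ c ≡ᵇ toℕ d) ∧ adj H x y

  copies-edgeless : Edgeless H → Edgeless (copies k H)
  copies-edgeless edgeless a b = trans (cong (_ ∧_) (edgeless _ _)) (∧-zeroʳ _)

  weightBy-copies : ∀ ℓ c x → weightBy (copies k H) ℓ (combine c x) ≡ weightBy H (ℓ ∘ combine c) x
  weightBy-copies ℓ c x = begin
    weightBy (copies k H) ℓ (combine c x)   ≡⟨ ∑-combine k (V H) _ ⟩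
    ∑[ d < k ] ∑[ y < V H ] (if adj (copies k H) (combine c x) (combine d y) then ℓ (combine d y) else 0)
      ≡⟨ sum-cong-≗ (λ d → sum-cong-≗ λ y →
           cong (λ b → if b then ℓ (combine d y) else 0) (copies-adj c x d y)) ⟩
    ∑[ d < k ] block d                      ≡⟨ ∑-concentrated k block c off-diagonal ⟩
    block c                                 ≡⟨ cong (λ b → ∑[ y < V H ] (if b ∧ adj H x y then ℓ (combine c y) else 0))
                                                    (≡ᵇ-refl (toℕ c)) ⟩
    weightBy H (ℓ ∘ combine c) x            ∎
    where
    open ≡-Reasoning
    block : Fin k → ℕ
    block d = ∑[ y < V H ] (if (toℕ c ≡ᵇ toℕ d) ∧ adj H x y then ℓ (combine d y) else 0)
    off-diagonal : ∀ d → d ≢ c → block d ≡ 0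
    off-diagonal d d≢c rewrite ≢⇒≡ᵇ-false (d≢c ∘ sym ∘ toℕ-injective) = ∑-zero (V H) _ (λ _ → refl)

Γ₉ Γ₄ : Graph
Γ₉ = ZDGraph 9
Γ₄ = ZDGraph 4

weightBy-Γ₉ : ∀ ℓ i → weightBy Γ₉ ℓ i ≡ ℓ (opposite i)
weightBy-Γ₉ ℓ F.zero         = +-identityʳ _
weightBy-Γ₉ ℓ (F.suc F.zero) = +-identityʳ _

Γ₄-edgeless : Edgeless Γ₄
Γ₄-edgeless F.zero F.zero = refl

¬HasDAML-Γ₉-twoΓ₄ : ∀ m k → ¬ HasDAML (join (copies m Γ₉) (copies (2 + k) Γ₄))
¬HasDAML-Γ₉-twoΓ₄ m k = join-edgeless-¬HasDAML (copies m Γ₉) (copies (2 + k) Γ₄)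
  (copies-edgeless (2 + k) Γ₄ Γ₄-edgeless) F.zero (F.suc F.zero) λ ()

offset≢multiple : ∀ {t d} k → t < d → suc t + suc d ≢ k * suc d
offset≢multiple {t} {d} k t<d eq = <⇒≱ (s≤s t<d) (∣⇒≤ (∣m+n∣m⇒∣n d∣d+t ∣-refl))
  where
  d∣d+t : suc d ∣ suc d + suc t
  d∣d+t = divides k (trans (+-comm (suc d) (suc t)) eq)

module Apex (m : ℕ) where

  G : Graph
  G = join (copies m Γ₉) (copies 1 Γ₄)

  ℓ : Fin (V G) → ℕ
  ℓ = suc ∘ toℕ

  apex : Fin (V G)
  apex = m * 2 ↑ʳ F.zero

  leaf : Fin m → Fin 2 → Fin (V G)
  leaf c i = combine c i ↑ˡ 1

  data Vertex : Fin (V G) → Set where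
    leafᵛ : ∀ c i → Vertex (leaf c i)
    apexᵛ : Vertex apex

  vertex : ∀ u → Vertex u
  vertex u = subst Vertex (join-splitAt (m * 2) 1 u) (fromSplit (splitAt (m * 2) u))
    where
    fromSplit : ∀ s → Vertex (F.join (m * 2) 1 s)
    fromSplit (inj₁ x)      = subst (λ x → Vertex (x ↑ˡ 1)) (combine-remQuot {m} 2 x) (leafᵛ _ _)
    fromSplit (inj₂ F.zero) = apexᵛ

  weight-apex : weightBy G ℓ apex ≡ m * suc (m * 2)
  weight-apex = begin
    weightBy G ℓ apex
      ≡⟨ weightBy-join-ʳ (copies m Γ₉) (copies 1 Γ₄) ℓ F.zero ⟩
    ∑[ x < m * 2 ] ℓ (x ↑ˡ 1) + weightBy (copies 1 Γ₄) (ℓ ∘ (m * 2 ↑ʳ_)) F.zero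
      ≡⟨ cong₂ _+_ (sum-cong-≗ {m * 2} λ x → cong suc (toℕ-↑ˡ x 1))
                   (weightBy-edgeless _ (copies-edgeless 1 Γ₄ Γ₄-edgeless) (ℓ ∘ (m * 2 ↑ʳ_)) F.zero) ⟩
    ∑[ x < m * 2 ] suc (toℕ x) + 0
      ≡⟨ +-identityʳ _ ⟩
    ∑[ x < m * 2 ] suc (toℕ x)
      ≡⟨ ∑-suc-toℕ-even m ⟩
    m * suc (m * 2) ∎
    where open ≡-Reasoning

  weight-leaf : ∀ c i → weightBy G ℓ (leaf c i) ≡ suc (toℕ (combine c (opposite i))) + suc (m * 2)
  weight-leaf c i = begin
    weightBy G ℓ (leaf c i)
      ≡⟨ weightBy-join-ˡ (copies m Γ₉) (copies 1 Γ₄) ℓ (combine c i) ⟩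
    weightBy (copies m Γ₉) (ℓ ∘ (_↑ˡ 1)) (combine c i) + (ℓ apex + 0)
      ≡⟨ cong (_+ (ℓ apex + 0)) (trans (weightBy-copies m Γ₉ _ c i) (weightBy-Γ₉ (λ j → ℓ (leaf c j)) i)) ⟩
    ℓ (leaf c (opposite i)) + (ℓ apex + 0)
      ≡⟨ cong₂ _+_ (cong suc (toℕ-↑ˡ _ 1))
                   (trans (+-identityʳ _) (cong suc (trans (toℕ-↑ʳ (m * 2) (F.zero {0})) (+-identityʳ _)))) ⟩
    suc (toℕ (combine c (opposite i))) + suc (m * 2) ∎
    where open ≡-Reasoning

  leaf≢apex : ∀ c i → weightBy G ℓ (leaf c i) ≢ weightBy G ℓ apex
  leaf≢apex c i eq = offset≢multiple m (toℕ<n (combine c (opposite i)))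
    (trans (sym (weight-leaf c i)) (trans eq weight-apex))

  leaf-injective : ∀ c i d j → weightBy G ℓ (leaf c i) ≡ weightBy G ℓ (leaf d j) → leaf c i ≡ leaf d j
  leaf-injective c i d j eq
    with combine-injective c (opposite i) d (opposite j) (toℕ-injective (suc-injective
           (+-cancelʳ-≡ (suc (m * 2)) _ _ (trans (sym (weight-leaf c i)) (trans eq (weight-leaf d j))))))
  ... | refl , oi≡oj = cong (leaf c) (begin
    i                       ≡⟨ opposite-involutive i ⟨
    opposite (opposite i)   ≡⟨ cong opposite oi≡oj ⟩
    opposite (opposite j)   ≡⟨ opposite-involutive j ⟩
    j                       ∎)
    where open ≡-Reasoning

  weightBy-injective : ∀ u v → weightBy G ℓ u ≡ weightBy G ℓ v → u ≡ v
  weightBy-injective u v eq with vertex u | vertex v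
  ... | leafᵛ c i | leafᵛ d j = leaf-injective c i d j eq
  ... | leafᵛ c i | apexᵛ     = contradiction eq (leaf≢apex c i)
  ... | apexᵛ     | leafᵛ d j = contradiction (sym eq) (leaf≢apex d j)
  ... | apexᵛ     | apexᵛ     = refl

  hasDAML : HasDAML G
  hasDAML = id , bijective _≡_ , λ {u} {v} eq →
    weightBy-injective u v (trans (sym (weight≡weightBy G id u)) (trans eq (weight≡weightBy G id v)))

theorem2p4 : (m n : ℕ) → 1 ≤ m → 1 ≤ n →
    HasDAML (join (copies m (ZDGraph 9)) (copies n (ZDGraph 4))) ⇔ (n ≡ 1)
theorem2p4 m zero          _ ()
theorem2p4 m (suc zero)    _ _ = mk⇔ (λ _ → refl) (λ _ → Apex.hasDAML m)
theorem2p4 m (suc (suc k)) _ _ = mk⇔ (λ daml → contradiction daml (¬HasDAML-Γ₉-twoΓ₄ m k)) (λ ())
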